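{- Let $d,e\in\mathbb{N}$, $\boldsymbol{\mu}=(\mu_1,\dots,\mu_d)\in\{\pm1\}^d$ and $\boldsymbol{\nu}=(\nu_1,\dots,\nu_e)\in\{\pm1\}^e$. Then for every sequence $\boldsymbol{\xi}\in \mathbf{p}(\boldsymbol{\mu})\,ш\,\mathbf{p}(\boldsymbol{\nu})$ we have $$\operatorname{sgn}_T\big(\mathbf{q}(\boldsymbol{\xi})\big)=\operatorname{sgn}_T(\boldsymbol{\mu})\,\operatorname{sgn}_T(\boldsymbol{\nu}).$$
   Context: For $\boldsymbol{\mu}=(\mu_1,\dots,\mu_n)\in\{\pm1\}^n$ define $\mathbf{p}(\boldsymbol{\mu})=(\mu_1,\mu_1\mu_2,\dots,\mu_1\mu_2\cdots\mu_n)$ and $\mathbf{q}(\boldsymbol{\mu})=(\mu_1,\mu_2\mu_1,\mu_3\mu_2,\dots,\mu_n\mu_{n-1})$, and the $T$-sign $\operatorname{sgn}_T(\boldsymbol{\mu})=\prod_{1\le j\le n,\ j\equiv n \pmod 2}\mu_j$. For sequences $\mathbf{a}=(a_1,\dots,a_d)$ and $\mathbf{b}=(b_1,\dots,b_e)$, $\mathbf{a}\,ш\,\mathbf{b}$ denotes the set of all sequences of length $d+e$ obtained by interleaving $\mathbf{a}$ and $\mathbf{b}$ while preserving the internal order of each (the shuffles of $\mathbf{a}$ and $\mathbf{b}$). -}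

module Defs where

open import Data.Nat using (ℕ; zero; suc; _%_)
open import Data.List using (List; []; _∷_; length; foldr)
open import Data.Sign using (Sign) renaming (_*_ to _·_; + to s+)
open import Relation.Nullary.Decidable using (does)
open import Data.Bool using (if_then_else_)
open import Data.Nat using (_≟_)

-- Signs ±1 are represented by Data.Sign.Sign (+ ↔ 1, - ↔ -1, _*_ multiplication).

pAux : Sign → List Sign → List Sign
pAux acc []       = []
pAux acc (m ∷ ms) = (acc · m) ∷ pAux (acc · m) ms

p : List Sign → List Sign
p = pAux s+

qAux : Sign → List Sign → List Sign
qAux prev []       = []
qAux prev (m ∷ ms) = (m · prev) ∷ qAux m ms

q : List Sign → List Sign
q = qAux s+

sgnTAux : ℕ → ℕ → List Sign → Sign
sgnTAux n j []       = s+
sgnTAux n j (m ∷ ms) =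
  (if does (j % 2 ≟ n % 2) then m else s+) · sgnTAux n (suc j) ms

-- T-sign: sgn_T(μ) = ∏_{1 ≤ j ≤ n, j ≡ n (mod 2)} μⱼ  where n = length μ
sgnT : List Sign → Sign
sgnT μ = sgnTAux (length μ) 1 μ

data Shuffle {A : Set} : List A → List A → List A → Set where
  sh-[] : Shuffle [] [] []
  sh-l  : ∀ {x a b ξ} → Shuffle a b ξ → Shuffle (x ∷ a) b (x ∷ ξ)
  sh-r  : ∀ {y a b ξ} → Shuffle a b ξ → Shuffle a (y ∷ b) (y ∷ ξ)

{-# OPTIONS --safe #-}
module Submission where

-- The entries of q(ξ) at the positions j ≡ n (mod 2) are ξₙξₙ₋₁, ξₙ₋₂ξₙ₋₃, …,
-- ending with ξ₂ξ₁ or ξ₁, so sgn_T(q(ξ)) telescopes to the product of all entries of ξ.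
-- Since q undoes p, this gives sgn_T(μ) = sgn_T(q(p(μ))) = ∏ p(μ), and the product of a
-- shuffle of p(μ) and p(ν) is ∏ p(μ) · ∏ p(ν).

open import Defs
open import Data.Nat using (ℕ; zero; suc; _%_; _≟_)
open import Data.Vec using (Vec; toList)
open import Data.List using (List; []; _∷_; length; foldr)
open import Data.Sign using (Sign; _*_) renaming (+ to s+)
open import Data.Sign.Properties using (*-comm; *-assoc; *-identityʳ; s*s≡+)
open import Data.Bool using (Bool; true; false; not; if_then_else_)
open import Data.Bool.Properties using (if-eta)
open import Relation.Nullary.Decidable using (does)
open import Relation.Binary.PropositionalEquality using (_≡_; refl; sym; trans; cong; cong₂; module ≡-Reasoning)
open ≡-Reasoning

product : List Sign → Sign
product = foldr _*_ s+

alternatingProduct : Bool → List Sign → Sign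
alternatingProduct b []       = s+
alternatingProduct b (m ∷ ms) = (if b then m else s+) * alternatingProduct (not b) ms

hasOddLength : {A : Set} → List A → Bool
hasOddLength []       = false
hasOddLength (_ ∷ xs) = not (hasOddLength xs)

sameParity : ℕ → ℕ → Bool
sameParity a b = does (a % 2 ≟ b % 2)

sameParity-sucˡ : ∀ a b → sameParity (suc a) b ≡ not (sameParity a b)
sameParity-sucˡ (suc (suc a)) b             = sameParity-sucˡ a b
sameParity-sucˡ zero          zero          = refl
sameParity-sucˡ zero          (suc zero)    = refl
sameParity-sucˡ zero          (suc (suc b)) = sameParity-sucˡ zero b
sameParity-sucˡ (suc zero)    zero          = refl
sameParity-sucˡ (suc zero)    (suc zero)    = refl
sameParity-sucˡ (suc zero)    (suc (suc b)) = sameParity-sucˡ (suc zero) b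

sameParity-sucʳ : ∀ a b → sameParity a (suc b) ≡ not (sameParity a b)
sameParity-sucʳ a (suc (suc b))             = sameParity-sucʳ a b
sameParity-sucʳ zero          zero          = refl
sameParity-sucʳ (suc zero)    zero          = refl
sameParity-sucʳ (suc (suc a)) zero          = sameParity-sucʳ a zero
sameParity-sucʳ zero          (suc zero)    = refl
sameParity-sucʳ (suc zero)    (suc zero)    = refl
sameParity-sucʳ (suc (suc a)) (suc zero)    = sameParity-sucʳ a (suc zero)

sgnTAux≡alternatingProduct : ∀ n j ms → sgnTAux n j ms ≡ alternatingProduct (sameParity j n) ms
sgnTAux≡alternatingProduct n j []       = refl
sgnTAux≡alternatingProduct n j (m ∷ ms) = cong ((if sameParity j n then m else s+) *_) (begin
  sgnTAux n (suc j) ms                              ≡⟨ sgnTAux≡alternatingProduct n (suc j) ms ⟩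
  alternatingProduct (sameParity (suc j) n) ms      ≡⟨ cong (λ b → alternatingProduct b ms) (sameParity-sucˡ j n) ⟩
  alternatingProduct (not (sameParity j n)) ms      ∎)

sameParity-1-length : {A : Set} (xs : List A) → sameParity 1 (length xs) ≡ hasOddLength xs
sameParity-1-length []       = refl
sameParity-1-length (_ ∷ xs) = trans (sameParity-sucʳ 1 (length xs)) (cong not (sameParity-1-length xs))

sgnT≡alternatingProduct : ∀ ms → sgnT ms ≡ alternatingProduct (hasOddLength ms) ms
sgnT≡alternatingProduct ms =
  trans (sgnTAux≡alternatingProduct (length ms) 1 ms)
        (cong (λ b → alternatingProduct b ms) (sameParity-1-length ms))

hasOddLength-qAux : ∀ prev xs → hasOddLength (qAux prev xs) ≡ hasOddLength xs
hasOddLength-qAux prev []       = refl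
hasOddLength-qAux prev (x ∷ xs) = cong not (hasOddLength-qAux x xs)

alternatingProduct-qAux : ∀ prev xs →
  alternatingProduct (hasOddLength xs) (qAux prev xs) ≡ product xs * (if hasOddLength xs then prev else s+)
alternatingProduct-qAux prev []       = refl
alternatingProduct-qAux prev (x ∷ xs) with hasOddLength xs | alternatingProduct-qAux x xs
... | true  | ih = begin
  alternatingProduct true (qAux x xs)   ≡⟨ ih ⟩
  product xs * x                        ≡⟨ *-comm (product xs) x ⟩
  x * product xs                        ≡⟨ sym (*-identityʳ _) ⟩
  (x * product xs) * s+                 ∎
... | false | ih = begin
  (x * prev) * alternatingProduct false (qAux x xs)  ≡⟨ cong ((x * prev) *_) (trans ih (*-identityʳ _)) ⟩
  (x * prev) * product xs                            ≡⟨ *-assoc x prev (product xs) ⟩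
  x * (prev * product xs)                            ≡⟨ cong (x *_) (*-comm prev (product xs)) ⟩
  x * (product xs * prev)                            ≡⟨ sym (*-assoc x (product xs) prev) ⟩
  (x * product xs) * prev                            ∎

sgnT∘q≡product : ∀ xs → sgnT (q xs) ≡ product xs
sgnT∘q≡product xs = begin
  sgnT (q xs)                                          ≡⟨ sgnT≡alternatingProduct (q xs) ⟩
  alternatingProduct (hasOddLength (q xs)) (q xs)      ≡⟨ cong (λ b → alternatingProduct b (q xs)) (hasOddLength-qAux s+ xs) ⟩
  alternatingProduct (hasOddLength xs) (q xs)          ≡⟨ alternatingProduct-qAux s+ xs ⟩
  product xs * (if hasOddLength xs then s+ else s+)    ≡⟨ cong (product xs *_) (if-eta (hasOddLength xs)) ⟩
  product xs * s+                                      ≡⟨ *-identityʳ (product xs) ⟩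
  product xs                                           ∎

qAux∘pAux : ∀ acc ms → qAux acc (pAux acc ms) ≡ ms
qAux∘pAux acc []       = refl
qAux∘pAux acc (m ∷ ms) = cong₂ _∷_ cancel (qAux∘pAux (acc * m) ms)
  where
  cancel : (acc * m) * acc ≡ m
  cancel = begin
    (acc * m) * acc    ≡⟨ *-comm (acc * m) acc ⟩
    acc * (acc * m)    ≡⟨ sym (*-assoc acc acc m) ⟩
    (acc * acc) * m    ≡⟨ cong (_* m) (s*s≡+ acc) ⟩
    m                  ∎

sgnT≡product∘p : ∀ ms → sgnT ms ≡ product (p ms)
sgnT≡product∘p ms = trans (cong sgnT (sym (qAux∘pAux s+ ms))) (sgnT∘q≡product (p ms))

product-shuffle : ∀ {a b ξ} → Shuffle a b ξ → product ξ ≡ product a * product b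
product-shuffle sh-[] = refl
product-shuffle (sh-l {x} {a} {b} {ξ} s) = begin
  x * product ξ                    ≡⟨ cong (x *_) (product-shuffle s) ⟩
  x * (product a * product b)      ≡⟨ sym (*-assoc x (product a) (product b)) ⟩
  (x * product a) * product b      ∎
product-shuffle (sh-r {y} {a} {b} {ξ} s) = begin
  y * product ξ                    ≡⟨ cong (y *_) (product-shuffle s) ⟩
  y * (product a * product b)      ≡⟨ sym (*-assoc y (product a) (product b)) ⟩
  (y * product a) * product b      ≡⟨ cong (_* product b) (*-comm y (product a)) ⟩
  (product a * y) * product b      ≡⟨ *-assoc (product a) y (product b) ⟩
  product a * (y * product b)      ∎

proposition2p8 : (d e : ℕ) (μ : Vec Sign d) (ν : Vec Sign e) (ξ : List Sign) →
    Shuffle (p (toList μ)) (p (toList ν)) ξ →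
    sgnT (q ξ) ≡ sgnT (toList μ) * sgnT (toList ν)
proposition2p8 d e μ ν ξ s = begin
  sgnT (q ξ)                                       ≡⟨ sgnT∘q≡product ξ ⟩
  product ξ                                        ≡⟨ product-shuffle s ⟩
  product (p (toList μ)) * product (p (toList ν))  ≡⟨ sym (cong₂ _*_ (sgnT≡product∘p (toList μ))
                                                                      (sgnT≡product∘p (toList ν))) ⟩
  sgnT (toList μ) * sgnT (toList ν)                ∎
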